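{- Let $p$ be an odd prime and let $n,s$ be positive integers such that $r = 2n/s \geq 3$ is an odd integer. Put $q = p^n$, $d = p^s$, and let $\mathbb{F}_q$ be the subfield of $\mathbb{F}_{q^2}$ of order $q$. There exists $\mu \in \mathbb{F}_{q^2} \setminus \mathbb{F}_q$ such that, writing $\mu^d = u_1 + u_2 \mu$ with $u_1,u_2 \in \mathbb{F}_q$, the element $u_2$ is a $(d-1)$-th power of some element of $\mathbb{F}_{q^2}$. -}

module Defs where

open import Level using (Level; _⊔_)
open import Data.Nat using (ℕ)
import Data.Nat as ℕ
open import Data.Fin using (Fin)
open import Data.Product using (Σ; ∃; _×_)
open import Relation.Nullary using (¬_)
open import Relation.Binary.PropositionalEquality using (_≡_)
open import Algebra.Bundles using (CommutativeRing)

Odd : ℕ → Set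
Odd m = ∃ λ k → m ≡ 1 ℕ.+ 2 ℕ.* k

module _ {c ℓ : Level} (R : CommutativeRing c ℓ) where
  open CommutativeRing R

  IsField : Set (c ⊔ ℓ)
  IsField = (¬ (1# ≈ 0#)) × (∀ x → ¬ (x ≈ 0#) → ∃ λ y → x * y ≈ 1#)

  HasSize : ℕ → Set (c ⊔ ℓ)
  HasSize N = Σ (Fin N → Carrier) λ f →
    (∀ i j → f i ≈ f j → i ≡ j) × (∀ x → ∃ λ i → f i ≈ x)

  IsSubfield : {k : Level} → (Carrier → Set k) → Set (c ⊔ ℓ ⊔ k)
  IsSubfield K =
    (∀ {x y} → x ≈ y → K x → K y) ×
    K 0# × K 1# ×
    (∀ {x y} → K x → K y → K (x + y)) ×
    (∀ {x} → K x → K (- x)) ×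
    (∀ {x y} → K x → K y → K (x * y)) ×
    (∀ {x y} → K x → x * y ≈ 1# → K y)

  SubsetHasSize : {k : Level} → (Carrier → Set k) → ℕ → Set (c ⊔ ℓ ⊔ k)
  SubsetHasSize K N = Σ (Fin N → Carrier) λ f →
    (∀ i → K (f i)) × (∀ i j → f i ≈ f j → i ≡ j) × (∀ x → K x → ∃ λ i → f i ≈ x)

module Submission where

-- Write s = 2t, n = (1 + 2k)t, P = p^t, so d = P², q = P·d^k and
-- |F| = Q = q² = d^(1+2k).  Put M = (Q - 1)/(d - 1) = 1 + d + ⋯ + d^(2k).  By Fermat's little
-- theorem (x^Q = x on F) every M-th power μ = x^M satisfies μ^d = μ, i.e. μ^d = 0 + 1·μ with
-- u₁ = 0, u₂ = 1 = 1^(d-1) in K.  It remains to find x with x^M ∉ K.  If all M-th powers lay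
-- in K, then z = x^M would satisfy z^q = z (Fermat in K) as well as z^d = z, hence z^P = z;
-- so x^(MP) = x^M for all x ∈ F.  A nonzero polynomial of degree MP has at most MP roots,
-- while Q = 1 + (d - 1)M > PM: a contradiction.  Decidability of K then yields an explicit x.

open import Defs
open import Level using (Level)
open import Function using (_∘_)
open import Data.Nat using (ℕ; zero; suc; _≤_; _<_; z≤n; s≤s)
import Data.Nat as ℕ
open import Data.Nat.Properties using (suc-injective; +-suc; m≤n⇒∃[o]m+o≡n)
open import Data.Nat.Primality using (Prime; prime⇒nonTrivial)
import Data.Fin.Properties as Fin
open import Data.List using (List; []; _∷_; length; map; filter; foldr; tabulate)
open import Data.List.Properties
  using (length-map; length-tabulate; length-removeAt′; filter-all; filter-reject)
open import Data.List.Relation.Unary.All as All using (All; []; _∷_)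
open import Data.List.Relation.Unary.All.Properties
  using (all-filter) renaming (tabulate⁺ to all-tabulate)
open import Data.List.Relation.Unary.Any using (here; there; index)
open import Data.List.Relation.Unary.AllPairs using (_∷_)
open import Data.Vec using (Vec; []; _∷_; replicate; _++_)
open import Data.Product using (∃; _×_; _,_; proj₁; proj₂)
open import Data.Unit using (⊤; tt)
open import Data.Empty using (⊥-elim)
open import Relation.Nullary using (¬_; Dec; yes; no; ¬?)
open import Relation.Binary using (Decidable; _Respects_)
open import Relation.Binary.PropositionalEquality as ≡ using (_≡_)
open import Algebra.Bundles using (CommutativeRing; Semiring)
import Algebra.Definitions.RawSemiring as RS

module ExponentArithmetic where
  open import Data.Nat
  open import Data.Nat.Properties
  open import Data.Nat.Tactic.RingSolver using (solve-∀)
  open import Relation.Binary.PropositionalEquality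
  open ≡-Reasoning

  geometric : ℕ → ℕ → ℕ
  geometric d zero    = 0
  geometric d (suc m) = suc (d * geometric d m)

  pow≡1+geometric : ∀ d′ m → suc d′ ^ m ≡ suc (d′ * geometric (suc d′) m)
  pow≡1+geometric d′ zero    = cong suc (sym (*-zeroʳ d′))
  pow≡1+geometric d′ (suc m) = begin
    suc d′ * suc d′ ^ m                    ≡⟨ cong (suc d′ *_) (pow≡1+geometric d′ m) ⟩
    suc d′ * suc (d′ * G)                  ≡⟨ step d′ G ⟩
    suc (d′ * suc (suc d′ * G))            ∎
    where
    G = geometric (suc d′) m
    step : ∀ d′ G → suc d′ * suc (d′ * G) ≡ suc (d′ * suc (suc d′ * G))
    step = solve-∀

  odd*s≡even : ∀ k s n → (1 + 2 * k) * s ≡ 2 * n → ∃ λ t → s ≡ 2 * t × n ≡ (1 + 2 * k) * t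
  odd*s≡even k s n rs≡2n = t , s≡2t , n≡rt
    where
    t = n ∸ k * s
    expand : ∀ k s → (1 + 2 * k) * s ≡ s + 2 * (k * s)
    expand = solve-∀
    s≡2t : s ≡ 2 * t
    s≡2t = sym (begin
      2 * (n ∸ k * s)                 ≡⟨ *-distribˡ-∸ 2 n (k * s) ⟩
      2 * n ∸ 2 * (k * s)             ≡⟨ cong (_∸ 2 * (k * s)) (trans (sym rs≡2n) (expand k s)) ⟩
      s + 2 * (k * s) ∸ 2 * (k * s)   ≡⟨ m+n∸n≡m s (2 * (k * s)) ⟩
      s                               ∎)
    pull-2 : ∀ r t → r * (2 * t) ≡ 2 * (r * t)
    pull-2 = solve-∀
    n≡rt : n ≡ (1 + 2 * k) * t
    n≡rt = *-cancelˡ-≡ n ((1 + 2 * k) * t) 2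
             (trans (sym rs≡2n) (trans (cong ((1 + 2 * k) *_) s≡2t) (pull-2 (1 + 2 * k) t)))

  -- The exponents attached to d = P², q = P^(1+2k) and Q = q² = d^(1+2k):
  -- M = 1 + d + ⋯ + d^(2k) = (Q - 1)/(d - 1), written M = 1 + M′.
  record Exponents (d q Q k : ℕ) : Set where
    field
      P M′    : ℕ
      q≡P*dᵏ  : q ≡ P * d ^ k
      Md≡Q+M′ : suc M′ * d ≡ Q + M′
      M<MP    : suc M′ < suc M′ * P
      MP<Q    : suc M′ * P < Q

    M : ℕ
    M = suc M′

  square : ∀ m → m ^ 2 ≡ m * m
  square m = cong (m *_) (*-identityʳ m)

  exponents-of-base : ∀ P k → 2 ≤ P → Exponents (P * P) (P ^ (1 + 2 * k)) ((P ^ (1 + 2 * k)) ^ 2) k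
  exponents-of-base (suc zero) k (s≤s ())
  exponents-of-base P@(suc (suc a)) k _ = record
    { P = P ; M′ = M′ ; q≡P*dᵏ = q≡P*dᵏ ; Md≡Q+M′ = Md≡Q+M′ ; M<MP = m<m*n M P (s≤s (s≤s z≤n))
    ; MP<Q = MP<Q }
    where
    r  = 1 + 2 * k
    d′ = suc a + suc a * P     -- P * P ≡ suc d′ definitionally
    M′ = suc d′ * geometric (suc d′) (2 * k)
    M  = suc M′
    Q≡1+d′M : (P ^ r) ^ 2 ≡ suc (d′ * M)
    Q≡1+d′M = begin
      (P ^ r) ^ 2    ≡⟨ ^-*-assoc P r 2 ⟩
      P ^ (r * 2)    ≡⟨ cong (P ^_) (*-comm r 2) ⟩
      P ^ (2 * r)    ≡⟨ sym (^-*-assoc P 2 r) ⟩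
      (P ^ 2) ^ r    ≡⟨ cong (_^ r) (square P) ⟩
      suc d′ ^ r     ≡⟨ pow≡1+geometric d′ r ⟩
      suc (d′ * M)   ∎
    q≡P*dᵏ : P ^ r ≡ P * (P * P) ^ k
    q≡P*dᵏ = cong (P *_) (begin
      P ^ (2 * k)    ≡⟨ sym (^-*-assoc P 2 k) ⟩
      (P ^ 2) ^ k    ≡⟨ cong (_^ k) (square P) ⟩
      (P * P) ^ k    ∎)
    rearrange : ∀ M′ d′ → suc M′ * suc d′ ≡ suc (d′ * suc M′) + M′
    rearrange = solve-∀
    Md≡Q+M′ : M * suc d′ ≡ (P ^ r) ^ 2 + M′
    Md≡Q+M′ = trans (rearrange M′ d′) (cong (_+ M′) (sym Q≡1+d′M))
    P≤d′ : P ≤ d′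
    P≤d′ = ≤-trans (m≤n*m P (suc a)) (m≤n+m (suc a * P) (suc a))
    MP<Q : M * P < (P ^ r) ^ 2
    MP<Q = subst (M * P <_) (sym Q≡1+d′M) (s≤s (subst (M * P ≤_) (*-comm M d′) (*-monoʳ-≤ M P≤d′)))

  exponents : ∀ p n s k → 2 ≤ p → 1 ≤ s → (1 + 2 * k) * s ≡ 2 * n →
              Exponents (p ^ s) (p ^ n) ((p ^ n) ^ 2) k
  exponents p n s k 2≤p 1≤s rs≡2n with odd*s≡even k s n rs≡2n
  ... | t , s≡2t , n≡rt =
    subst₂ (λ d q → Exponents d q (q ^ 2) k) (sym p^s≡P*P) (sym p^n≡P^r)
           (exponents-of-base (p ^ t) k 2≤P)
    where
    positive-half : ∀ t → 1 ≤ 2 * t → 1 ≤ t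
    positive-half (suc _) _ = s≤s z≤n
    1≤t : 1 ≤ t
    1≤t = positive-half t (subst (1 ≤_) s≡2t 1≤s)
    2≤P : 2 ≤ p ^ t
    2≤P = ≤-trans 2≤p (subst (_≤ p ^ t) (^-identityʳ p) (^-monoʳ-≤ p {{p≢0}} 1≤t))
      where p≢0 = >-nonZero (<-trans (s≤s z≤n) 2≤p)
    p^s≡P*P : p ^ s ≡ p ^ t * p ^ t
    p^s≡P*P = begin
      p ^ s          ≡⟨ cong (p ^_) (trans s≡2t (*-comm 2 t)) ⟩
      p ^ (t * 2)    ≡⟨ sym (^-*-assoc p t 2) ⟩
      (p ^ t) ^ 2    ≡⟨ square (p ^ t) ⟩
      p ^ t * p ^ t  ∎
    p^n≡P^r : p ^ n ≡ (p ^ t) ^ (1 + 2 * k)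
    p^n≡P^r = begin
      p ^ n                  ≡⟨ cong (p ^_) (trans n≡rt (*-comm (1 + 2 * k) t)) ⟩
      p ^ (t * (1 + 2 * k))  ≡⟨ sym (^-*-assoc p t (1 + 2 * k)) ⟩
      (p ^ t) ^ (1 + 2 * k)  ∎

module PowerLaws {c ℓ} (S : Semiring c ℓ) where
  open Semiring S
  open RS rawSemiring using (_^_)
  open import Algebra.Properties.Semiring.Exp S using (^-congˡ; ^-homo-*; ^-assocʳ)
  open import Relation.Binary.Reasoning.Setoid setoid

  1^ : ∀ m → 1# ^ m ≈ 1#
  1^ zero    = refl
  1^ (suc m) = trans (*-identityˡ _) (1^ m)

  fixed-iterate : ∀ {z} d → z ^ d ≈ z → ∀ k → z ^ (d ℕ.^ k) ≈ z
  fixed-iterate d z^d≈z zero    = *-identityʳ _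
  fixed-iterate {z} d z^d≈z (suc k) = begin
    z ^ (d ℕ.* d ℕ.^ k)    ≈⟨ sym (^-assocʳ z d (d ℕ.^ k)) ⟩
    (z ^ d) ^ (d ℕ.^ k)    ≈⟨ ^-congˡ (d ℕ.^ k) z^d≈z ⟩
    z ^ (d ℕ.^ k)          ≈⟨ fixed-iterate d z^d≈z k ⟩
    z                      ∎

  -- If z is fixed by z ↦ z^d and by z ↦ z^(P d^k), then it is fixed by z ↦ z^P:
  -- z^P is again fixed by z ↦ z^d, hence by its k-th iterate.
  fixed-by-factor : ∀ {z} P d k → z ^ d ≈ z → z ^ (P ℕ.* d ℕ.^ k) ≈ z → z ^ P ≈ z
  fixed-by-factor {z} P d k z^d≈z z^q≈z = begin
    z ^ P                    ≈⟨ sym (fixed-iterate d z^P-fixed k) ⟩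
    (z ^ P) ^ (d ℕ.^ k)      ≈⟨ ^-assocʳ z P (d ℕ.^ k) ⟩
    z ^ (P ℕ.* d ℕ.^ k)      ≈⟨ z^q≈z ⟩
    z                        ∎
    where
    open import Data.Nat.Properties using (*-comm)
    z^P-fixed : (z ^ P) ^ d ≈ z ^ P
    z^P-fixed = begin
      (z ^ P) ^ d      ≈⟨ ^-assocʳ z P d ⟩
      z ^ (P ℕ.* d)    ≡⟨ ≡.cong (z ^_) (*-comm P d) ⟩
      z ^ (d ℕ.* P)    ≈⟨ sym (^-assocʳ z d P) ⟩
      (z ^ d) ^ P      ≈⟨ ^-congˡ P z^d≈z ⟩
      z ^ P            ∎

  fixed-power : ∀ {x} Q M′ d → x ^ Q ≈ x → suc M′ ℕ.* d ≡ Q ℕ.+ M′ → (x ^ suc M′) ^ d ≈ x ^ suc M′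
  fixed-power {x} Q M′ d x^Q≈x Md≡Q+M′ = begin
    (x ^ suc M′) ^ d       ≈⟨ ^-assocʳ x (suc M′) d ⟩
    x ^ (suc M′ ℕ.* d)     ≡⟨ ≡.cong (x ^_) Md≡Q+M′ ⟩
    x ^ (Q ℕ.+ M′)         ≈⟨ ^-homo-* x Q M′ ⟩
    x ^ Q * x ^ M′         ≈⟨ *-congʳ x^Q≈x ⟩
    x ^ suc M′             ∎

module FieldTheory {c ℓ} (F : CommutativeRing c ℓ) (isField : IsField F) where
  open CommutativeRing F
  open RS (Semiring.rawSemiring semiring) using (_^_)
  open PowerLaws semiring public
  open import Algebra.Properties.Semiring.Exp semiring using (^-congʳ; ^-homo-*)
  open import Algebra.Properties.Ring ring using (-‿distribʳ-*)
  open import Algebra.Properties.AbelianGroup +-abelianGroup using (xyx⁻¹≈y)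
  open import Algebra.Properties.Group +-group using (x∙y⁻¹≈ε⇒x≈y)
  open import Algebra.Properties.CommutativeSemigroup *-commutativeSemigroup
    using (interchange; x∙yz≈y∙xz)
  open import Relation.Binary.Reasoning.Setoid setoid
  open import Data.List.Membership.Setoid setoid using (_∈_; _─_)
  open import Data.List.Membership.Setoid.Properties
    using (∈-resp-≈; ∈-map⁻; ∈-filter⁺; ∈-filter⁻; ∈-tabulate⁺; ∈-tabulate⁻; All[≉]⇒∉)
  open import Data.List.Relation.Unary.Unique.Setoid setoid using (Unique)
  import Data.List.Relation.Unary.Unique.Setoid.Properties as Unique

  1≉0 : 1# ≉ 0#
  1≉0 = proj₁ isField

  *-cancelˡ : ∀ {x u v} → x ≉ 0# → x * u ≈ x * v → u ≈ v
  *-cancelˡ {x} {u} {v} x≉0 xu≈xv with proj₂ isField x x≉0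
  ... | x⁻¹ , xx⁻¹≈1 = begin
    u                ≈⟨ sym (*-identityˡ u) ⟩
    1# * u           ≈⟨ *-congʳ x⁻¹x≈1 ⟨
    (x⁻¹ * x) * u    ≈⟨ *-assoc x⁻¹ x u ⟩
    x⁻¹ * (x * u)    ≈⟨ *-congˡ xu≈xv ⟩
    x⁻¹ * (x * v)    ≈⟨ *-assoc x⁻¹ x v ⟨
    (x⁻¹ * x) * v    ≈⟨ *-congʳ x⁻¹x≈1 ⟩
    1# * v           ≈⟨ *-identityˡ v ⟩
    v                ∎
    where
    x⁻¹x≈1 : x⁻¹ * x ≈ 1#
    x⁻¹x≈1 = trans (*-comm x⁻¹ x) xx⁻¹≈1

  no-zero-divisors : ∀ {x y} → x ≉ 0# → x * y ≈ 0# → y ≈ 0#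
  no-zero-divisors {x} x≉0 xy≈0 = *-cancelˡ x≉0 (trans xy≈0 (sym (zeroʳ x)))

  *-nonzero : ∀ {x y} → x ≉ 0# → y ≉ 0# → x * y ≉ 0#
  *-nonzero x≉0 y≉0 xy≈0 = y≉0 (no-zero-divisors x≉0 xy≈0)

  prod : List Carrier → Carrier
  prod = foldr _*_ 1#

  prod-─ : ∀ {b A} (b∈A : b ∈ A) → prod A ≈ b * prod (A ─ b∈A)
  prod-─ {A = a ∷ A} (here b≈a)  = *-congʳ (sym b≈a)
  prod-─ {b} {a ∷ A} (there b∈A) = begin
    a * prod A                  ≈⟨ *-congˡ (prod-─ b∈A) ⟩
    a * (b * prod (A ─ b∈A))    ≈⟨ x∙yz≈y∙xz a b _ ⟩
    b * (a * prod (A ─ b∈A))    ∎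

  ∈-─ : ∀ {b y A} (b∈A : b ∈ A) → y ∈ A → b ≉ y → y ∈ (A ─ b∈A)
  ∈-─ (here b≈a)  (here y≈a)  b≉y = ⊥-elim (b≉y (trans b≈a (sym y≈a)))
  ∈-─ (here _)    (there y∈A) _   = y∈A
  ∈-─ (there _)   (here y≈a)  _   = here y≈a
  ∈-─ (there b∈A) (there y∈A) b≉y = there (∈-─ b∈A y∈A b≉y)

  -- A repetition-free list B contained in a list A of the same length is a rearrangement
  -- of A, so both have the same product.
  prod-⊆ : ∀ {A B} → Unique B → length A ≡ length B → (∀ {y} → y ∈ B → y ∈ A) → prod A ≈ prod B
  prod-⊆ {[]}    {[]}    _ _  _ = refl
  prod-⊆ {_ ∷ _} {[]}    _ () _
  prod-⊆ {A}     {b ∷ B} (b∉B ∷ B!) |A|≡|b∷B| b∷B⊆A = begin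
    prod A                ≈⟨ prod-─ b∈A ⟩
    b * prod (A ─ b∈A)    ≈⟨ *-congˡ (prod-⊆ B! |A─b|≡|B| B⊆A─b) ⟩
    b * prod B            ∎
    where
    b∈A : b ∈ A
    b∈A = b∷B⊆A (here refl)
    |A─b|≡|B| : length (A ─ b∈A) ≡ length B
    |A─b|≡|B| = suc-injective (≡.trans (≡.sym (length-removeAt′ A (index b∈A))) |A|≡|b∷B|)
    B⊆A─b : ∀ {y} → y ∈ B → y ∈ (A ─ b∈A)
    B⊆A─b y∈B = ∈-─ b∈A (b∷B⊆A (there y∈B))
                    (λ b≈y → All[≉]⇒∉ setoid b∉B (∈-resp-≈ setoid (sym b≈y) y∈B))

  prod-map-* : ∀ x L → prod (map (x *_) L) ≈ x ^ length L * prod L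
  prod-map-* x []      = sym (*-identityˡ 1#)
  prod-map-* x (y ∷ L) = begin
    x * y * prod (map (x *_) L)        ≈⟨ *-congˡ (prod-map-* x L) ⟩
    x * y * (x ^ length L * prod L)    ≈⟨ interchange x y _ _ ⟩
    x * x ^ length L * (y * prod L)    ∎

  prod-nonzero : ∀ {L} → All (_≉ 0#) L → prod L ≉ 0#
  prod-nonzero []            = 1≉0
  prod-nonzero (y≉0 ∷ L≉0) = *-nonzero y≉0 (prod-nonzero L≉0)

  -- Lagrange: if a repetition-free list U of nonzero elements is closed under y ↦ x y,
  -- then multiplication by x permutes U, and comparing products gives x^|U| = 1.
  lagrange : ∀ {x U} → x ≉ 0# → Unique U → All (_≉ 0#) U →
             (∀ {y} → y ∈ U → x * y ∈ U) → x ^ length U ≈ 1#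
  lagrange {x} {U} x≉0 U! U≉0 xU⊆U = *-cancelˡ (prod-nonzero U≉0) (begin
    prod U * x ^ length U     ≈⟨ *-comm _ _ ⟩
    x ^ length U * prod U     ≈⟨ prod-map-* x U ⟨
    prod (map (x *_) U)       ≈⟨ U≈xU ⟨
    prod U                    ≈⟨ *-identityʳ _ ⟨
    prod U * 1#               ∎)
    where
    U≈xU : prod U ≈ prod (map (x *_) U)
    U≈xU = prod-⊆ (Unique.map⁺ setoid setoid (*-cancelˡ x≉0) U!) (≡.sym (length-map (x *_) U))
             (λ y∈xU → let z , z∈U , y≈xz = ∈-map⁻ setoid setoid y∈xU
                       in ∈-resp-≈ setoid (sym y≈xz) (xU⊆U z∈U))

  module Fermat (_≟_ : Decidable _≈_) where

    nonzero? : ∀ x → Dec (x ≉ 0#)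
    nonzero? x = ¬? (x ≟ 0#)

    length-nonzero : ∀ {L} → Unique L → 0# ∈ L → length L ≡ suc (length (filter nonzero? L))
    length-nonzero {y ∷ L} (y∉L ∷ _) (here 0≈y) =
      ≡.cong (suc ∘ length) (≡.sym (≡.trans (filter-reject nonzero? (λ y≉0 → y≉0 (sym 0≈y)))
                                             (filter-all nonzero? L≉0)))
      where
      L≉0 : All (_≉ 0#) L
      L≉0 = All.map (λ y≉z z≈0 → y≉z (trans (sym 0≈y) (sym z≈0))) y∉L
    length-nonzero {y ∷ L} (y∉L ∷ L!) (there 0∈L) with y ≟ 0#
    ... | yes y≈0 = ⊥-elim (All[≉]⇒∉ setoid y∉L (∈-resp-≈ setoid (sym y≈0) 0∈L))
    ... | no  _   = ≡.cong suc (length-nonzero L! 0∈L)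

    -- Fermat: in a finite repetition-free list L ∋ 0 closed under multiplication, x^|L| = x,
    -- by Lagrange applied to the nonzero entries of L.
    fermat : ∀ {L} → Unique L → 0# ∈ L → (∀ {x y} → x ∈ L → y ∈ L → x * y ∈ L) →
             ∀ {x} → x ∈ L → x ^ length L ≈ x
    fermat {L} L! 0∈L closed {x} x∈L with x ≟ 0#
    ... | yes x≈0 = begin
      x ^ length L          ≡⟨ ≡.cong (x ^_) (length-nonzero L! 0∈L) ⟩
      x * x ^ length L*     ≈⟨ *-congʳ x≈0 ⟩
      0# * x ^ length L*    ≈⟨ zeroˡ _ ⟩
      0#                    ≈⟨ x≈0 ⟨
      x                     ∎
      where L* = filter nonzero? L
    ... | no x≉0 = begin
      x ^ length L          ≡⟨ ≡.cong (x ^_) (length-nonzero L! 0∈L) ⟩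
      x * x ^ length L*     ≈⟨ *-congˡ (lagrange x≉0 (Unique.filter⁺ setoid nonzero? L!)
                                                 (all-filter nonzero? L) xL*⊆L*) ⟩
      x * 1#                ≈⟨ *-identityʳ x ⟩
      x                     ∎
      where
      L* = filter nonzero? L
      nonzero-resp : ∀ {y z} → y ≈ z → y ≉ 0# → z ≉ 0#
      nonzero-resp y≈z y≉0 z≈0 = y≉0 (trans y≈z z≈0)
      xL*⊆L* : ∀ {y} → y ∈ L* → x * y ∈ L*
      xL*⊆L* y∈L* = let y∈L , y≉0 = ∈-filter⁻ setoid nonzero? nonzero-resp y∈L*
                    in ∈-filter⁺ setoid nonzero? nonzero-resp (closed x∈L y∈L) (*-nonzero x≉0 y≉0)

  -- The monic polynomial c₀ + c₁ X + ⋯ + c_{m-1} X^(m-1) + X^m of degree m,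
  -- represented by its lower coefficients (c₀, …, c_{m-1}).
  eval : ∀ {m} → Vec Carrier m → Carrier → Carrier
  eval []        x = 1#
  eval (c₀ ∷ cs) x = c₀ + x * eval cs x

  -- Synthetic division by X - a: the quotient of the monic polynomial c₀ ∷ cs
  -- (it does not depend on c₀).
  quotient : ∀ {m} → Carrier → Vec Carrier m → Vec Carrier m
  quotient a []        = []
  quotient a (c₁ ∷ cs) = eval (c₁ ∷ cs) a ∷ quotient a cs

  split-at : ∀ c₀ x a R → c₀ + x * R ≈ (c₀ + a * R) + (x - a) * R
  split-at c₀ x a R = begin
    c₀ + x * R                   ≈⟨ +-congˡ (*-congʳ a+[x-a]≈x) ⟨
    c₀ + (a + (x - a)) * R       ≈⟨ +-congˡ (distribʳ R a (x - a)) ⟩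
    c₀ + (a * R + (x - a) * R)   ≈⟨ +-assoc c₀ _ _ ⟨
    (c₀ + a * R) + (x - a) * R   ∎
    where
    a+[x-a]≈x : a + (x - a) ≈ x
    a+[x-a]≈x = trans (sym (+-assoc a x (- a))) (xyx⁻¹≈y a x)

  division : ∀ {m} a c₀ (cs : Vec Carrier m) x →
             eval (c₀ ∷ cs) x ≈ eval (c₀ ∷ cs) a + (x - a) * eval (quotient a cs) x
  division a c₀ []        x = split-at c₀ x a 1#
  division a c₀ (c₁ ∷ cs) x = begin
    c₀ + x * eval (c₁ ∷ cs) x                          ≈⟨ +-congˡ (*-congˡ (division a c₁ cs x)) ⟩
    c₀ + x * (R + (x - a) * Q)                         ≈⟨ +-congˡ (distribˡ x R _) ⟩
    c₀ + (x * R + x * ((x - a) * Q))                   ≈⟨ +-assoc c₀ _ _ ⟨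
    (c₀ + x * R) + x * ((x - a) * Q)
      ≈⟨ +-cong (split-at c₀ x a R) (x∙yz≈y∙xz x (x - a) Q) ⟩
    ((c₀ + a * R) + (x - a) * R) + (x - a) * (x * Q)   ≈⟨ +-assoc _ _ _ ⟩
    (c₀ + a * R) + ((x - a) * R + (x - a) * (x * Q))   ≈⟨ +-congˡ (distribˡ (x - a) R _) ⟨
    (c₀ + a * R) + (x - a) * (R + x * Q)               ∎
    where
    R = eval (c₁ ∷ cs) a
    Q = eval (quotient a cs) x

  -- A monic polynomial of degree m has at most m distinct roots: every root other than a
  -- root y is a root of the quotient by X - y, which has degree m - 1.
  roots-bound : ∀ {m} (cs : Vec Carrier m) {ys} → Unique ys → All (λ y → eval cs y ≈ 0#) ys →
                length ys ≤ m
  roots-bound cs        {[]}     _           _               = z≤n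
  roots-bound []        {_ ∷ _}  _           (1≈0 ∷ _)       = ⊥-elim (1≉0 1≈0)
  roots-bound (c₀ ∷ cs) {y ∷ ys} (y∉ys ∷ ys!) (fy≈0 ∷ fys≈0) =
    s≤s (roots-bound (quotient y cs) ys! (All.zipWith root-of-quotient (y∉ys , fys≈0)))
    where
    root-of-quotient : ∀ {z} → y ≉ z × eval (c₀ ∷ cs) z ≈ 0# → eval (quotient y cs) z ≈ 0#
    root-of-quotient {z} (y≉z , fz≈0) = no-zero-divisors z-y≉0 (begin
      (z - y) * q                        ≈⟨ +-identityˡ _ ⟨
      0# + (z - y) * q                   ≈⟨ +-congʳ fy≈0 ⟨
      eval (c₀ ∷ cs) y + (z - y) * q     ≈⟨ division y c₀ cs z ⟨
      eval (c₀ ∷ cs) z                   ≈⟨ fz≈0 ⟩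
      0#                                 ∎)
      where
      q = eval (quotient y cs) z
      z-y≉0 : z - y ≉ 0#
      z-y≉0 z-y≈0 = y≉z (sym (x∙y⁻¹≈ε⇒x≈y z y z-y≈0))

  eval-monomial : ∀ m x → eval (replicate m 0#) x ≈ x ^ m
  eval-monomial zero    x = refl
  eval-monomial (suc m) x = trans (+-identityˡ _) (*-congˡ (eval-monomial m x))

  eval-shifted : ∀ {m} b (cs : Vec Carrier m) x → eval (replicate b 0# ++ cs) x ≈ x ^ b * eval cs x
  eval-shifted zero    cs x = sym (*-identityˡ _)
  eval-shifted (suc b) cs x = begin
    0# + x * eval (replicate b 0# ++ cs) x   ≈⟨ +-identityˡ _ ⟩
    x * eval (replicate b 0# ++ cs) x        ≈⟨ *-congˡ (eval-shifted b cs x) ⟩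
    x * (x ^ b * eval cs x)                  ≈⟨ *-assoc _ _ _ ⟨
    x * x ^ b * eval cs x                    ∎

  -- The monic polynomial X^(b + 1 + m) - X^b = X^b (X^(1+m) - 1).
  binomial : ∀ b m → Vec Carrier (b ℕ.+ suc m)
  binomial b m = replicate b 0# ++ (- 1# ∷ replicate m 0#)

  binomial-root : ∀ b m x → x ^ (b ℕ.+ suc m) ≈ x ^ b → eval (binomial b m) x ≈ 0#
  binomial-root b m x x^a≈x^b = begin
    eval (binomial b m) x                    ≈⟨ eval-shifted b _ x ⟩
    x ^ b * (- 1# + x * eval (replicate m 0#) x)
      ≈⟨ *-congˡ (+-congˡ (*-congˡ (eval-monomial m x))) ⟩
    x ^ b * (- 1# + x ^ suc m)               ≈⟨ distribˡ (x ^ b) _ _ ⟩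
    x ^ b * - 1# + x ^ b * x ^ suc m
      ≈⟨ +-cong (-‿distribʳ-* (x ^ b) 1#) (^-homo-* x b (suc m)) ⟨
    - (x ^ b * 1#) + x ^ (b ℕ.+ suc m)       ≈⟨ +-cong (-‿cong (*-identityʳ _)) x^a≈x^b ⟩
    - x ^ b + x ^ b                          ≈⟨ -‿inverseˡ _ ⟩
    0#                                       ∎

  binomial-bound : ∀ {a b ys} → b < a → Unique ys → All (λ y → y ^ a ≈ y ^ b) ys → length ys ≤ a
  binomial-bound {b = b} {ys} b<a ys! sols with m≤n⇒∃[o]m+o≡n b<a
  ... | m , ≡.refl = ≡.subst (length ys ≤_) (+-suc b m)
      (roots-bound (binomial b m) ys! (All.map root sols))
    where
    root : ∀ {y} → y ^ suc (b ℕ.+ m) ≈ y ^ b → eval (binomial b m) y ≈ 0#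
    root {y} y^a≈y^b = binomial-root b m y (trans (^-congʳ y (+-suc b m)) y^a≈y^b)

  finite⇒decidable : ∀ {N} → HasSize F N → Decidable _≈_
  finite⇒decidable (f , injective , surjective) x y
    with surjective x | surjective y
  ... | i , fi≈x | j , fj≈y with i Fin.≟ j
  ... | yes ≡.refl = yes (trans (sym fi≈x) fj≈y)
  ... | no  i≢j    = no (λ x≈y → i≢j (injective i j (trans fi≈x (trans x≈y (sym fj≈y)))))

  subset-decidable : ∀ {k} {K : Carrier → Set k} {N} → Decidable _≈_ → K Respects _≈_ →
                     SubsetHasSize F K N → ∀ y → Dec (K y)
  subset-decidable _≟_ K-resp (g , g∈K , _ , onto) y with Fin.any? (λ j → g j ≟ y)
  ... | yes (j , gj≈y) = yes (K-resp gj≈y (g∈K j))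
  ... | no  ∄j         = no (λ Ky → ∄j (onto y Ky))

  subset-fermat : ∀ {k} {K : Carrier → Set k} {N} → Decidable _≈_ → K Respects _≈_ → K 0# →
                  (∀ {x y} → K x → K y → K (x * y)) → SubsetHasSize F K N → ∀ {y} → K y → y ^ N ≈ y
  subset-fermat {K = K} {N} _≟_ K-resp K0 K-closed (g , g∈K , injective , onto) {y} Ky = begin
    y ^ N            ≡⟨ ≡.cong (y ^_) (length-tabulate g) ⟨
    y ^ length L     ≈⟨ fermat (Unique.tabulate⁺ setoid (injective _ _)) (listed K0)
                          (λ x∈L y∈L → listed (K-closed (in-K x∈L) (in-K y∈L))) (listed Ky) ⟩
    y                ∎
    where
    open Fermat _≟_
    L = tabulate g
    listed : ∀ {x} → K x → x ∈ L
    listed {x} Kx = let j , gj≈x = onto x Kx in ∈-resp-≈ setoid gj≈x (∈-tabulate⁺ setoid j)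
    in-K : ∀ {x} → x ∈ L → K x
    in-K x∈L = let j , x≈gj = ∈-tabulate⁻ setoid x∈L in K-resp (sym x≈gj) (g∈K j)

  field-fermat : ∀ {N} → HasSize F N → ∀ x → x ^ N ≈ x
  field-fermat |F|@(f , injective , surjective) x =
    subset-fermat {K = λ _ → ⊤} (finite⇒decidable |F|) (λ _ _ → tt) tt (λ _ _ → tt)
      (f , (λ _ → tt) , injective , λ y _ → surjective y) tt

  field-binomial-bound : ∀ {N a b} → HasSize F N → b < a → (∀ x → x ^ a ≈ x ^ b) → N ≤ a
  field-binomial-bound {a = a} (f , injective , _) b<a identity =
    ≡.subst (_≤ a) (length-tabulate f)
      (binomial-bound b<a (Unique.tabulate⁺ setoid (injective _ _)) (all-tabulate (identity ∘ f)))

  finite-search : ∀ {N p} {P : Carrier → Set p} → HasSize F N → P Respects _≈_ →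
                  (∀ x → Dec (P x)) → ¬ (∀ x → P x) → ∃ λ x → ¬ P x
  finite-search {N} {P = P} (f , _ , surjective) P-resp P? ¬∀P =
    let i , ¬Pfi = Fin.¬∀⟶∃¬ N (P ∘ f) (P? ∘ f) everywhere⇒¬∀ in f i , ¬Pfi
    where
    everywhere⇒¬∀ : ¬ (∀ i → P (f i))
    everywhere⇒¬∀ ∀i = ¬∀P (λ x → let i , fi≈x = surjective x in P-resp fi≈x (∀i i))

open ExponentArithmetic using (Exponents; exponents)

module _ {c ℓ} (F : CommutativeRing c ℓ) (isField : IsField F) where
  open CommutativeRing F
  open RS (Semiring.rawSemiring semiring) using (_^_)
  open FieldTheory F isField
  open import Algebra.Properties.Semiring.Exp semiring using (^-congʳ; ^-assocʳ)
  open import Data.Nat.Properties using (≤⇒≯)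

  -- Key lemma: not every M-th power lies in K.  Otherwise z = x^M satisfies z^d = z and
  -- z^q = z, hence z^P = z, so x^(MP) = x^M on all of F, contradicting |F| = Q > MP.
  powers-escape : ∀ {k} {K : Carrier → Set k} {d q Q e} (E : Exponents d q Q e) → HasSize F Q →
                  (∀ {y} → K y → y ^ q ≈ y) → ¬ (∀ x → K (x ^ Exponents.M E))
  powers-escape {d = d} {Q = Q} {e} E |F| K-fermat all-in-K =
    ≤⇒≯ (field-binomial-bound |F| M<MP x^MP≈x^M) MP<Q
    where
    open Exponents E
    x^MP≈x^M : ∀ x → x ^ (M ℕ.* P) ≈ x ^ M
    x^MP≈x^M x = trans (sym (^-assocʳ x M P)) (fixed-by-factor P d e z^d≈z z^q≈z)
      where
      z^d≈z : (x ^ M) ^ d ≈ x ^ M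
      z^d≈z = fixed-power Q M′ d (field-fermat |F| x) Md≡Q+M′
      z^q≈z : (x ^ M) ^ (P ℕ.* d ℕ.^ e) ≈ x ^ M
      z^q≈z = trans (^-congʳ (x ^ M) (≡.sym q≡P*dᵏ)) (K-fermat (all-in-K x))

mainTheorem7 : ∀ {c ℓ k : Level} (p n s r : ℕ) → Prime p → Odd p → 1 ≤ n → 1 ≤ s →
    r ℕ.* s ≡ 2 ℕ.* n → 3 ≤ r → Odd r →
    (F : CommutativeRing c ℓ) → IsField F → HasSize F ((p ℕ.^ n) ℕ.^ 2) →
    (K : CommutativeRing.Carrier F → Set k) → IsSubfield F K → SubsetHasSize F K (p ℕ.^ n) →
    let open CommutativeRing F
        open RS (Semiring.rawSemiring semiring) using (_^_)
        d = p ℕ.^ s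
    in ∃ λ μ → ¬ K μ × (∃ λ u₁ → ∃ λ u₂ → K u₁ × K u₂ × (μ ^ d ≈ u₁ + u₂ * μ) ×
         (∃ λ w → w ^ (d ℕ.∸ 1) ≈ u₂))
mainTheorem7 p n s _ p-prime _ _ 1≤s rs≡2n _ (k , ≡.refl) F isField |F| K
             (K-resp , K0 , K1 , _ , _ , K-closed , _) |K| =
  μ , μ∉K , 0# , 1# , K0 , K1 , μ^d≈0+1μ , 1# , 1^ (p ℕ.^ s ℕ.∸ 1)
  where
  open CommutativeRing F
  open RS (Semiring.rawSemiring semiring) using (_^_)
  open FieldTheory F isField
  open import Algebra.Properties.Semiring.Exp semiring using (^-congˡ)

  E : Exponents (p ℕ.^ s) (p ℕ.^ n) ((p ℕ.^ n) ℕ.^ 2) k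
  E = exponents p n s k (ℕ.nonTrivial⇒n>1 p {{prime⇒nonTrivial p-prime}}) 1≤s rs≡2n
  open Exponents E

  _≟_ : Decidable _≈_
  _≟_ = finite⇒decidable |F|

  escape : ∃ λ x → ¬ K (x ^ M)
  escape = finite-search |F| (K-resp ∘ ^-congˡ M) (subset-decidable _≟_ K-resp |K| ∘ (_^ M))
             (powers-escape F isField E |F| (subset-fermat _≟_ K-resp K0 K-closed |K|))

  x : Carrier
  x = proj₁ escape

  μ : Carrier
  μ = x ^ M

  μ∉K : ¬ K μ
  μ∉K = proj₂ escape

  μ^d≈0+1μ : μ ^ (p ℕ.^ s) ≈ 0# + 1# * μ
  μ^d≈0+1μ = trans (fixed-power ((p ℕ.^ n) ℕ.^ 2) M′ (p ℕ.^ s) (field-fermat |F| x) Md≡Q+M′)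
                   (sym (trans (+-identityˡ (1# * μ)) (*-identityˡ μ)))
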